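{- Let $(\mathcal C,\otimes,I,\gamma)$ be a symmetric monoidal category and $(\mathcal T,\eta,\mu,\tau)$ a centralisable strong monad on it, and for each object $X$ let $(\mathcal ZX,\iota_X)$ be a terminal central cone of $\mathcal T$ at $X$. Then the assignment $X\mapsto\mathcal ZX$ extends to a commutative strong monad $(\mathcal Z,\eta^{\mathcal Z},\mu^{\mathcal Z},\tau^{\mathcal Z})$ on $\mathcal C$, and the morphisms $\iota_X:\mathcal ZX\to\mathcal TX$ constitute a monomorphism of strong monads $\iota:\mathcal Z\Rightarrow\mathcal T$; in particular $\mathcal Z$ is a commutative submonad of $\mathcal T$.
   Context: Right strength: $\tau'_{X,Y}=\mathcal T(\gamma_{Y,X})\circ\tau_{Y,X}\circ\gamma_{\mathcal TX,Y}$. A strong monad is commutative if $\mu_{X\otimes Y}\circ\mathcal T\tau'_{X,Y}\circ\tau_{\mathcal TX,Y}=\mu_{X\otimes Y}\circ\mathcal T\tau_{X,Y}\circ\tau'_{X,\mathcal TY}$ for all $X,Y$. A central cone of $\mathcal T$ at $X$ is a pair $(Z,\iota)$ with $\iota:Z\to\mathcal TX$ such that for every object $Y$, $\mu_{X\otimes Y}\circ\mathcal T\tau'_{X,Y}\circ\tau_{\mathcal TX,Y}\circ(\iota\otimes\mathrm{id}_{\mathcal TY})=\mu_{X\otimes Y}\circ\mathcal T\tau_{X,Y}\circ\tau'_{X,\mathcal TY}\circ(\iota\otimes\mathrm{id}_{\mathcal TY})$; a morphism of central cones $(Z',\iota')\to(Z,\iota)$ is $\varphi$ with $\iota\circ\varphi=\iota'$;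 a terminal central cone is a terminal object among central cones at $X$. $\mathcal T$ is centralisable if it has a terminal central cone at every object. A morphism of strong monads $\iota:\mathcal S\Rightarrow\mathcal T$ is a natural transformation with $\iota\circ\eta^{\mathcal S}=\eta^{\mathcal T}$, $\iota_X\circ\mu^{\mathcal S}_X=\mu^{\mathcal T}_X\circ\mathcal T\iota_X\circ\iota_{\mathcal SX}$, $\iota_{X\otimes Y}\circ\tau^{\mathcal S}_{X,Y}=\tau^{\mathcal T}_{X,Y}\circ(X\otimes\iota_Y)$; a (strong) submonad is given by a monomorphism in the category of strong monads on $\mathcal C$. -}

module Defs where

open import Level using (Level; _⊔_) renaming (suc to lsuc)
open import Relation.Binary.PropositionalEquality using (_≡_)
open import Data.Product using (Σ; _,_; proj₁; proj₂; _×_)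

record Category (o ℓ : Level) : Set (lsuc (o ⊔ ℓ)) where
  infixr 9 _∘_
  field
    Obj : Set o
    _⇒_ : Obj → Obj → Set ℓ
    id  : ∀ {A} → A ⇒ A
    _∘_ : ∀ {A B C} → B ⇒ C → A ⇒ B → A ⇒ C
    identityˡ : ∀ {A B} {f : A ⇒ B} → id ∘ f ≡ f
    identityʳ : ∀ {A B} {f : A ⇒ B} → f ∘ id ≡ f
    assoc : ∀ {A B C D} {f : A ⇒ B} {g : B ⇒ C} {h : C ⇒ D} →
            (h ∘ g) ∘ f ≡ h ∘ (g ∘ f)

record SymmetricMonoidal {o ℓ} (C : Category o ℓ) : Set (o ⊔ ℓ) where
  open Category C
  infixr 10 _⊗₀_ _⊗₁_
  field
    _⊗₀_ : Obj → Obj → Obj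
    _⊗₁_ : ∀ {A B X Y} → A ⇒ B → X ⇒ Y → (A ⊗₀ X) ⇒ (B ⊗₀ Y)
    ⊗-id : ∀ {A B} → id {A} ⊗₁ id {B} ≡ id
    ⊗-∘  : ∀ {A B D X Y Z} {f : A ⇒ B} {g : B ⇒ D} {h : X ⇒ Y} {k : Y ⇒ Z} →
           (g ∘ f) ⊗₁ (k ∘ h) ≡ (g ⊗₁ k) ∘ (f ⊗₁ h)
    unit : Obj
    λ⇒ : ∀ {X} → (unit ⊗₀ X) ⇒ X
    λ⇐ : ∀ {X} → X ⇒ (unit ⊗₀ X)
    λ-iso₁ : ∀ {X} → λ⇒ {X} ∘ λ⇐ {X} ≡ id
    λ-iso₂ : ∀ {X} → λ⇐ {X} ∘ λ⇒ {X} ≡ id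
    λ-nat : ∀ {X Y} {f : X ⇒ Y} → f ∘ λ⇒ ≡ λ⇒ ∘ (id ⊗₁ f)
    ρ⇒ : ∀ {X} → (X ⊗₀ unit) ⇒ X
    ρ⇐ : ∀ {X} → X ⇒ (X ⊗₀ unit)
    ρ-iso₁ : ∀ {X} → ρ⇒ {X} ∘ ρ⇐ {X} ≡ id
    ρ-iso₂ : ∀ {X} → ρ⇐ {X} ∘ ρ⇒ {X} ≡ id
    ρ-nat : ∀ {X Y} {f : X ⇒ Y} → f ∘ ρ⇒ ≡ ρ⇒ ∘ (f ⊗₁ id)
    α⇒ : ∀ {X Y Z} → ((X ⊗₀ Y) ⊗₀ Z) ⇒ (X ⊗₀ (Y ⊗₀ Z))
    α⇐ : ∀ {X Y Z} → (X ⊗₀ (Y ⊗₀ Z)) ⇒ ((X ⊗₀ Y) ⊗₀ Z)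
    α-iso₁ : ∀ {X Y Z} → α⇒ {X} {Y} {Z} ∘ α⇐ ≡ id
    α-iso₂ : ∀ {X Y Z} → α⇐ {X} {Y} {Z} ∘ α⇒ ≡ id
    α-nat : ∀ {X X' Y Y' Z Z'} {f : X ⇒ X'} {g : Y ⇒ Y'} {h : Z ⇒ Z'} →
            α⇒ ∘ ((f ⊗₁ g) ⊗₁ h) ≡ (f ⊗₁ (g ⊗₁ h)) ∘ α⇒
    triangle : ∀ {X Y} → (id {X} ⊗₁ λ⇒ {Y}) ∘ α⇒ ≡ ρ⇒ ⊗₁ id
    pentagon : ∀ {W X Y Z} →
               (id {W} ⊗₁ α⇒ {X} {Y} {Z}) ∘ α⇒ ∘ (α⇒ ⊗₁ id) ≡ α⇒ ∘ α⇒
    γ : ∀ {X Y} → (X ⊗₀ Y) ⇒ (Y ⊗₀ X)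
    γ-nat : ∀ {X X' Y Y'} {f : X ⇒ X'} {g : Y ⇒ Y'} → γ ∘ (f ⊗₁ g) ≡ (g ⊗₁ f) ∘ γ
    γ-inv : ∀ {X Y} → γ {Y} {X} ∘ γ {X} {Y} ≡ id
    hexagon : ∀ {X Y Z} →
              α⇒ {Y} {Z} {X} ∘ γ ∘ α⇒ ≡ (id ⊗₁ γ) ∘ α⇒ ∘ (γ ⊗₁ id)

module _ {o ℓ} {C : Category o ℓ} (M : SymmetricMonoidal C) where
  open Category C
  open SymmetricMonoidal M

  record StrongMonadOn (T₀ : Obj → Obj) : Set (o ⊔ ℓ) where
    field
      F₁ : ∀ {X Y} → X ⇒ Y → T₀ X ⇒ T₀ Y
      F-id : ∀ {X} → F₁ (id {X}) ≡ id
      F-∘ : ∀ {X Y Z} {f : X ⇒ Y} {g : Y ⇒ Z} → F₁ (g ∘ f) ≡ F₁ g ∘ F₁ f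
      η : ∀ X → X ⇒ T₀ X
      μ : ∀ X → T₀ (T₀ X) ⇒ T₀ X
      η-nat : ∀ {X Y} (f : X ⇒ Y) → η Y ∘ f ≡ F₁ f ∘ η X
      μ-nat : ∀ {X Y} (f : X ⇒ Y) → μ Y ∘ F₁ (F₁ f) ≡ F₁ f ∘ μ X
      μ-assoc : ∀ X → μ X ∘ F₁ (μ X) ≡ μ X ∘ μ (T₀ X)
      μ-unitˡ : ∀ X → μ X ∘ F₁ (η X) ≡ id
      μ-unitʳ : ∀ X → μ X ∘ η (T₀ X) ≡ id
      τ : ∀ X Y → (X ⊗₀ T₀ Y) ⇒ T₀ (X ⊗₀ Y)
      τ-nat : ∀ {X X' Y Y'} (f : X ⇒ X') (g : Y ⇒ Y') →
              τ X' Y' ∘ (f ⊗₁ F₁ g) ≡ F₁ (f ⊗₁ g) ∘ τ X Y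
      τ-λ : ∀ X → F₁ λ⇒ ∘ τ unit X ≡ λ⇒
      τ-α : ∀ X Y Z → F₁ α⇒ ∘ τ (X ⊗₀ Y) Z ≡ τ X (Y ⊗₀ Z) ∘ (id ⊗₁ τ Y Z) ∘ α⇒
      τ-η : ∀ X Y → τ X Y ∘ (id ⊗₁ η Y) ≡ η (X ⊗₀ Y)
      τ-μ : ∀ X Y → τ X Y ∘ (id ⊗₁ μ Y) ≡ μ (X ⊗₀ Y) ∘ F₁ (τ X Y) ∘ τ X (T₀ Y)

  StrongMonad : Set (o ⊔ ℓ)
  StrongMonad = Σ (Obj → Obj) StrongMonadOn

  record IsStrongMonadMorphism {S₀ T₀ : Obj → Obj}
         (S : StrongMonadOn S₀) (T : StrongMonadOn T₀)
         (ι : ∀ X → S₀ X ⇒ T₀ X) : Set (o ⊔ ℓ) where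
    private
      module S = StrongMonadOn S
      module T = StrongMonadOn T
    field
      natural : ∀ {X Y} (f : X ⇒ Y) → ι Y ∘ S.F₁ f ≡ T.F₁ f ∘ ι X
      unit-law : ∀ X → ι X ∘ S.η X ≡ T.η X
      mult-law : ∀ X → ι X ∘ S.μ X ≡ T.μ X ∘ T.F₁ (ι X) ∘ ι (S₀ X)
      strength-law : ∀ X Y → ι (X ⊗₀ Y) ∘ S.τ X Y ≡ T.τ X Y ∘ (id ⊗₁ ι Y)

  -- ι is a monomorphism in the category of strong monads on C
  -- (equality of morphisms of strong monads = componentwise equality).
  IsStrongMonadMono : {S₀ T₀ : Obj → Obj}
                      (S : StrongMonadOn S₀) (T : StrongMonadOn T₀)
                      (ι : ∀ X → S₀ X ⇒ T₀ X) → Set (o ⊔ ℓ)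
  IsStrongMonadMono {S₀} S T ι =
    (R : StrongMonad) (α β : ∀ X → proj₁ R X ⇒ S₀ X) →
    IsStrongMonadMorphism (proj₂ R) S α →
    IsStrongMonadMorphism (proj₂ R) S β →
    (∀ X → ι X ∘ α X ≡ ι X ∘ β X) → ∀ X → α X ≡ β X

  module _ {T₀ : Obj → Obj} (T : StrongMonadOn T₀) where
    open StrongMonadOn T

    τ′ : ∀ X Y → (T₀ X ⊗₀ Y) ⇒ T₀ (X ⊗₀ Y)
    τ′ X Y = F₁ (γ {Y} {X}) ∘ τ Y X ∘ γ {T₀ X} {Y}

    IsCommutative : Set (o ⊔ ℓ)
    IsCommutative = ∀ X Y →
      μ (X ⊗₀ Y) ∘ F₁ (τ′ X Y) ∘ τ (T₀ X) Y ≡ μ (X ⊗₀ Y) ∘ F₁ (τ X Y) ∘ τ′ X (T₀ Y)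

    IsCentral : (X : Obj) {Z : Obj} → Z ⇒ T₀ X → Set (o ⊔ ℓ)
    IsCentral X {Z} ι = ∀ Y →
      μ (X ⊗₀ Y) ∘ F₁ (τ′ X Y) ∘ τ (T₀ X) Y ∘ (ι ⊗₁ id {T₀ Y})
        ≡ μ (X ⊗₀ Y) ∘ F₁ (τ X Y) ∘ τ′ X (T₀ Y) ∘ (ι ⊗₁ id {T₀ Y})

    record CentralCone (X : Obj) : Set (o ⊔ ℓ) where
      field
        obj : Obj
        arr : obj ⇒ T₀ X
        central : IsCentral X arr

    IsTerminalCentralCone : ∀ {X} → CentralCone X → Set (o ⊔ ℓ)
    IsTerminalCentralCone {X} c = (c' : CentralCone X) →
      Σ (CentralCone.obj c' ⇒ CentralCone.obj c) λ φ →
        (CentralCone.arr c ∘ φ ≡ CentralCone.arr c') ×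
        (∀ ψ → CentralCone.arr c ∘ ψ ≡ CentralCone.arr c' → ψ ≡ φ)

    TerminalCentralCone : Obj → Set (o ⊔ ℓ)
    TerminalCentralCone X = Σ (CentralCone X) IsTerminalCentralCone

    Centralisable : Set (o ⊔ ℓ)
    Centralisable = (X : Obj) → TerminalCentralCone X

-- Call f : A → T X central when, for every g : B → T Y, performing f before g and g
-- before f give the same Kleisli pairing A ⊗ B → T (X ⊗ Y); a central cone asks this
-- for g = id only, which suffices.  Central maps contain η and are closed under
-- precomposition, Kleisli composition and strength, so F f ∘ ι, η, μ ∘ T ι ∘ ι and
-- τ ∘ (id ⊗ ι) factor through the terminal central cones ι, which are monic.  Each
-- strong-monad law for 𝒵 follows from the law for T by cancelling ι, and 𝒵 is
-- commutative because ι X is central against ι Y.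

module Submission where

open import Level using (_⊔_)
open import Relation.Binary.PropositionalEquality
open import Data.Product using (Σ; _×_; proj₁; proj₂; _,_)
open import Defs

module CategoryReasoning {o ℓ} (C : Category o ℓ) where
  open Category C

  infixr 4 _⟩∘⟨_
  infixr 5 refl⟩∘⟨_
  infixl 6 _⟩∘⟨refl

  _⟩∘⟨_ : ∀ {A B D} {f f′ : B ⇒ D} {g g′ : A ⇒ B} → f ≡ f′ → g ≡ g′ → f ∘ g ≡ f′ ∘ g′
  _⟩∘⟨_ = cong₂ _∘_

  refl⟩∘⟨_ : ∀ {A B D} {f : B ⇒ D} {g g′ : A ⇒ B} → g ≡ g′ → f ∘ g ≡ f ∘ g′
  refl⟩∘⟨_ {f = f} = cong (f ∘_)

  _⟩∘⟨refl : ∀ {A B D} {f f′ : B ⇒ D} {g : A ⇒ B} → f ≡ f′ → f ∘ g ≡ f′ ∘ g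
  _⟩∘⟨refl {g = g} = cong (_∘ g)

  sym-assoc : ∀ {A B D E} {f : A ⇒ B} {g : B ⇒ D} {h : D ⇒ E} → h ∘ (g ∘ f) ≡ (h ∘ g) ∘ f
  sym-assoc = sym assoc

  pullˡ : ∀ {A B D E} {a : B ⇒ D} {b : A ⇒ B} {c : A ⇒ D} {f : E ⇒ A} →
          a ∘ b ≡ c → a ∘ (b ∘ f) ≡ c ∘ f
  pullˡ {f = f} p = trans sym-assoc (cong (_∘ f) p)

  cancelˡ : ∀ {A B D} {a : B ⇒ D} {b : D ⇒ B} {f : A ⇒ B} → b ∘ a ≡ id → b ∘ (a ∘ f) ≡ f
  cancelˡ p = trans (pullˡ p) identityˡ

module MonoidalProperties {o ℓ} {C : Category o ℓ} (M : SymmetricMonoidal C) where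
  open Category C
  open SymmetricMonoidal M
  open CategoryReasoning C
  open ≡-Reasoning

  id⊗-∘ : ∀ {X A B D} {f : A ⇒ B} {g : B ⇒ D} → id {X} ⊗₁ (g ∘ f) ≡ (id ⊗₁ g) ∘ (id ⊗₁ f)
  id⊗-∘ = trans (cong (_⊗₁ _) (sym identityˡ)) ⊗-∘

  ∘-⊗id : ∀ {X A B D} {f : A ⇒ B} {g : B ⇒ D} → (g ∘ f) ⊗₁ id {X} ≡ (g ⊗₁ id) ∘ (f ⊗₁ id)
  ∘-⊗id = trans (cong (_ ⊗₁_) (sym identityˡ)) ⊗-∘

  ⊗-interchange : ∀ {A B X Y} {f : A ⇒ B} {g : X ⇒ Y} →
                  (f ⊗₁ id) ∘ (id ⊗₁ g) ≡ (id ⊗₁ g) ∘ (f ⊗₁ id)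
  ⊗-interchange {f = f} {g} = begin
    (f ⊗₁ id) ∘ (id ⊗₁ g) ≡⟨ sym ⊗-∘ ⟩
    (f ∘ id) ⊗₁ (id ∘ g)  ≡⟨ cong₂ _⊗₁_ (trans identityʳ (sym identityˡ)) (trans identityˡ (sym identityʳ)) ⟩
    (id ∘ f) ⊗₁ (g ∘ id)  ≡⟨ ⊗-∘ ⟩
    (id ⊗₁ g) ∘ (f ⊗₁ id) ∎

  id⊗id-∘ : ∀ {A B D} {f : A ⇒ (B ⊗₀ D)} → (id ⊗₁ id) ∘ f ≡ f
  id⊗id-∘ = trans (⊗-id ⟩∘⟨refl) identityˡ

  ∘-id⊗id : ∀ {A B D} {f : (B ⊗₀ D) ⇒ A} → f ∘ (id ⊗₁ id) ≡ f
  ∘-id⊗id = trans (refl⟩∘⟨ ⊗-id) identityʳ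

  α⇒-id⊗ : ∀ {X A B B′} (g : B ⇒ B′) → α⇒ {X} {A} {B′} ∘ (id ⊗₁ g) ≡ (id ⊗₁ (id ⊗₁ g)) ∘ α⇒
  α⇒-id⊗ g = trans (refl⟩∘⟨ cong (_⊗₁ g) (sym ⊗-id)) α-nat

  hexagon⁻¹ : ∀ {W X V} → (γ {W} {X} ⊗₁ id {V}) ∘ α⇐ {W} {X} {V} ∘ γ {X ⊗₀ V} {W} ≡
              α⇐ {X} {W} {V} ∘ (id ⊗₁ γ {V} {W}) ∘ α⇒ {X} {V} {W}
  hexagon⁻¹ {W} {X} {V} = begin
    (γ ⊗₁ id) ∘ α⇐ ∘ γ                              ≡⟨ sym (cancelˡ α-iso₂) ⟩
    α⇐ ∘ α⇒ ∘ (γ ⊗₁ id) ∘ α⇐ ∘ γ                    ≡⟨ refl⟩∘⟨ pullˡ hexagon′ ⟩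
    α⇐ ∘ ((id ⊗₁ γ) ∘ α⇒ ∘ γ ∘ α⇒) ∘ α⇐ ∘ γ         ≡⟨ refl⟩∘⟨ trans assoc (refl⟩∘⟨ trans assoc (refl⟩∘⟨ assoc)) ⟩
    α⇐ ∘ (id ⊗₁ γ) ∘ α⇒ ∘ γ ∘ α⇒ ∘ α⇐ ∘ γ           ≡⟨ refl⟩∘⟨ refl⟩∘⟨ refl⟩∘⟨ refl⟩∘⟨ cancelˡ α-iso₁ ⟩
    α⇐ ∘ (id ⊗₁ γ) ∘ α⇒ ∘ γ ∘ γ                     ≡⟨ refl⟩∘⟨ refl⟩∘⟨ refl⟩∘⟨ γ-inv ⟩
    α⇐ ∘ (id ⊗₁ γ) ∘ α⇒ ∘ id                        ≡⟨ refl⟩∘⟨ refl⟩∘⟨ identityʳ ⟩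
    α⇐ ∘ (id ⊗₁ γ) ∘ α⇒                             ∎
    where
    id⊗γ-involutive : (id {X} ⊗₁ γ {V} {W}) ∘ (id ⊗₁ γ {W} {V}) ≡ id
    id⊗γ-involutive = trans (sym id⊗-∘) (trans (cong (id ⊗₁_) γ-inv) ⊗-id)

    hexagon′ : α⇒ {X} {W} {V} ∘ (γ {W} {X} ⊗₁ id) ≡
               (id ⊗₁ γ {V} {W}) ∘ α⇒ {X} {V} {W} ∘ γ {W} {X ⊗₀ V} ∘ α⇒ {W} {X} {V}
    hexagon′ = sym (trans (refl⟩∘⟨ hexagon) (cancelˡ id⊗γ-involutive))

module StrongMonadProperties {o ℓ} {C : Category o ℓ} (M : SymmetricMonoidal C)
  {T₀ : Category.Obj C → Category.Obj C} (T : StrongMonadOn M T₀) where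
  open Category C
  open SymmetricMonoidal M
  open StrongMonadOn T
  open CategoryReasoning C
  open MonoidalProperties M
  open ≡-Reasoning

  τʳ : ∀ X Y → (T₀ X ⊗₀ Y) ⇒ T₀ (X ⊗₀ Y)
  τʳ = τ′ M T

  extend : ∀ {A B} → A ⇒ T₀ B → T₀ A ⇒ T₀ B
  extend {B = B} f = μ B ∘ F₁ f

  extend∘η : ∀ {A B} (f : A ⇒ T₀ B) → extend f ∘ η A ≡ f
  extend∘η {A} {B} f = begin
    (μ B ∘ F₁ f) ∘ η A  ≡⟨ assoc ⟩
    μ B ∘ F₁ f ∘ η A    ≡⟨ refl⟩∘⟨ sym (η-nat f) ⟩
    μ B ∘ η (T₀ B) ∘ f  ≡⟨ cancelˡ (μ-unitʳ B) ⟩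
    f                   ∎

  extend-η : ∀ {A} → extend (η A) ≡ id
  extend-η {A} = μ-unitˡ A

  extend-η∘ : ∀ {A B} (f : A ⇒ B) → extend (η B ∘ f) ≡ F₁ f
  extend-η∘ {B = B} f = trans (refl⟩∘⟨ F-∘) (trans sym-assoc (trans (μ-unitˡ B ⟩∘⟨refl) identityˡ))

  extend∘F₁ : ∀ {A B D} (f : B ⇒ T₀ D) (h : A ⇒ B) → extend f ∘ F₁ h ≡ extend (f ∘ h)
  extend∘F₁ f h = trans assoc (refl⟩∘⟨ sym F-∘)

  F₁∘extend : ∀ {A B D} (h : B ⇒ D) (f : A ⇒ T₀ B) → F₁ h ∘ extend f ≡ extend (F₁ h ∘ f)
  F₁∘extend {B = B} {D} h f = begin
    F₁ h ∘ μ B ∘ F₁ f            ≡⟨ pullˡ (sym (μ-nat h)) ⟩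
    (μ D ∘ F₁ (F₁ h)) ∘ F₁ f     ≡⟨ assoc ⟩
    μ D ∘ F₁ (F₁ h) ∘ F₁ f       ≡⟨ refl⟩∘⟨ sym F-∘ ⟩
    extend (F₁ h ∘ f)            ∎

  extend∘extend : ∀ {A B D} (g : B ⇒ T₀ D) (f : A ⇒ T₀ B) →
                  extend g ∘ extend f ≡ extend (extend g ∘ f)
  extend∘extend {A} {B} {D} g f = begin
    (μ D ∘ F₁ g) ∘ μ B ∘ F₁ f                ≡⟨ assoc ⟩
    μ D ∘ F₁ g ∘ μ B ∘ F₁ f                  ≡⟨ refl⟩∘⟨ pullˡ (sym (μ-nat g)) ⟩
    μ D ∘ (μ (T₀ D) ∘ F₁ (F₁ g)) ∘ F₁ f      ≡⟨ refl⟩∘⟨ assoc ⟩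
    μ D ∘ μ (T₀ D) ∘ F₁ (F₁ g) ∘ F₁ f        ≡⟨ pullˡ (sym (μ-assoc D)) ⟩
    (μ D ∘ F₁ (μ D)) ∘ F₁ (F₁ g) ∘ F₁ f      ≡⟨ assoc ⟩
    μ D ∘ F₁ (μ D) ∘ F₁ (F₁ g) ∘ F₁ f        ≡⟨ refl⟩∘⟨ refl⟩∘⟨ sym F-∘ ⟩
    μ D ∘ F₁ (μ D) ∘ F₁ (F₁ g ∘ f)           ≡⟨ refl⟩∘⟨ sym F-∘ ⟩
    μ D ∘ F₁ (μ D ∘ F₁ g ∘ f)                ≡⟨ refl⟩∘⟨ cong F₁ sym-assoc ⟩
    extend (extend g ∘ f)                    ∎

  τ-natˡ : ∀ {A A′ B} (h : A ⇒ A′) → τ A′ B ∘ (h ⊗₁ id) ≡ F₁ (h ⊗₁ id) ∘ τ A B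
  τ-natˡ h = trans (refl⟩∘⟨ cong (h ⊗₁_) (sym F-id)) (τ-nat h id)

  τ-natʳ : ∀ {A B B′} (k : B ⇒ B′) → τ A B′ ∘ (id ⊗₁ F₁ k) ≡ F₁ (id ⊗₁ k) ∘ τ A B
  τ-natʳ k = τ-nat id k

  τ-extend : ∀ {X U V} (k : U ⇒ T₀ V) →
             τ X V ∘ (id ⊗₁ extend k) ≡ extend (τ X V ∘ (id ⊗₁ k)) ∘ τ X U
  τ-extend {X} {U} {V} k = begin
    τ X V ∘ (id ⊗₁ (μ V ∘ F₁ k))                       ≡⟨ refl⟩∘⟨ id⊗-∘ ⟩
    τ X V ∘ (id ⊗₁ μ V) ∘ (id ⊗₁ F₁ k)                 ≡⟨ pullˡ (τ-μ X V) ⟩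
    (μ _ ∘ F₁ (τ X V) ∘ τ X (T₀ V)) ∘ (id ⊗₁ F₁ k)     ≡⟨ trans assoc (refl⟩∘⟨ assoc) ⟩
    μ _ ∘ F₁ (τ X V) ∘ τ X (T₀ V) ∘ (id ⊗₁ F₁ k)       ≡⟨ refl⟩∘⟨ refl⟩∘⟨ τ-natʳ k ⟩
    μ _ ∘ F₁ (τ X V) ∘ F₁ (id ⊗₁ k) ∘ τ X U            ≡⟨ refl⟩∘⟨ pullˡ (sym F-∘) ⟩
    μ _ ∘ F₁ (τ X V ∘ (id ⊗₁ k)) ∘ τ X U               ≡⟨ sym-assoc ⟩
    extend (τ X V ∘ (id ⊗₁ k)) ∘ τ X U                 ∎

  τ-α⁻¹ : ∀ W X Y → τ W (X ⊗₀ Y) ∘ (id ⊗₁ τ X Y) ≡ F₁ α⇒ ∘ τ (W ⊗₀ X) Y ∘ α⇐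
  τ-α⁻¹ W X Y = sym (begin
    F₁ α⇒ ∘ τ (W ⊗₀ X) Y ∘ α⇐                      ≡⟨ pullˡ (τ-α W X Y) ⟩
    (τ W (X ⊗₀ Y) ∘ (id ⊗₁ τ X Y) ∘ α⇒) ∘ α⇐       ≡⟨ trans assoc (refl⟩∘⟨ assoc) ⟩
    τ W (X ⊗₀ Y) ∘ (id ⊗₁ τ X Y) ∘ α⇒ ∘ α⇐         ≡⟨ refl⟩∘⟨ refl⟩∘⟨ α-iso₁ ⟩
    τ W (X ⊗₀ Y) ∘ (id ⊗₁ τ X Y) ∘ id              ≡⟨ refl⟩∘⟨ identityʳ ⟩
    τ W (X ⊗₀ Y) ∘ (id ⊗₁ τ X Y)                   ∎)

  τ-α-nat : ∀ {X Y W B} (g : B ⇒ T₀ W) →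
            F₁ α⇒ ∘ τ (X ⊗₀ Y) W ∘ (id ⊗₁ g) ≡ τ X (Y ⊗₀ W) ∘ (id ⊗₁ (τ Y W ∘ (id ⊗₁ g))) ∘ α⇒
  τ-α-nat {X} {Y} {W} g = begin
    F₁ α⇒ ∘ τ (X ⊗₀ Y) W ∘ (id ⊗₁ g)                        ≡⟨ pullˡ (τ-α X Y W) ⟩
    (τ X (Y ⊗₀ W) ∘ (id ⊗₁ τ Y W) ∘ α⇒) ∘ (id ⊗₁ g)         ≡⟨ trans assoc (refl⟩∘⟨ assoc) ⟩
    τ X (Y ⊗₀ W) ∘ (id ⊗₁ τ Y W) ∘ α⇒ ∘ (id ⊗₁ g)           ≡⟨ refl⟩∘⟨ refl⟩∘⟨ α⇒-id⊗ g ⟩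
    τ X (Y ⊗₀ W) ∘ (id ⊗₁ τ Y W) ∘ (id ⊗₁ (id ⊗₁ g)) ∘ α⇒   ≡⟨ refl⟩∘⟨ pullˡ (sym id⊗-∘) ⟩
    τ X (Y ⊗₀ W) ∘ (id ⊗₁ (τ Y W ∘ (id ⊗₁ g))) ∘ α⇒         ∎

  τʳ-nat : ∀ {X X′ Y Y′} (h : X ⇒ X′) (k : Y ⇒ Y′) → τʳ X′ Y′ ∘ (F₁ h ⊗₁ k) ≡ F₁ (h ⊗₁ k) ∘ τʳ X Y
  τʳ-nat {X} {X′} {Y} {Y′} h k = begin
    (F₁ γ ∘ τ Y′ X′ ∘ γ) ∘ (F₁ h ⊗₁ k)     ≡⟨ trans assoc (refl⟩∘⟨ assoc) ⟩
    F₁ γ ∘ τ Y′ X′ ∘ γ ∘ (F₁ h ⊗₁ k)       ≡⟨ refl⟩∘⟨ refl⟩∘⟨ γ-nat ⟩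
    F₁ γ ∘ τ Y′ X′ ∘ (k ⊗₁ F₁ h) ∘ γ       ≡⟨ refl⟩∘⟨ pullˡ (τ-nat k h) ⟩
    F₁ γ ∘ (F₁ (k ⊗₁ h) ∘ τ Y X) ∘ γ       ≡⟨ refl⟩∘⟨ assoc ⟩
    F₁ γ ∘ F₁ (k ⊗₁ h) ∘ τ Y X ∘ γ         ≡⟨ pullˡ (sym F-∘) ⟩
    F₁ (γ ∘ (k ⊗₁ h)) ∘ τ Y X ∘ γ          ≡⟨ trans (cong F₁ γ-nat) F-∘ ⟩∘⟨refl ⟩
    (F₁ (h ⊗₁ k) ∘ F₁ γ) ∘ τ Y X ∘ γ       ≡⟨ assoc ⟩
    F₁ (h ⊗₁ k) ∘ τʳ X Y                   ∎

  τʳ-natʳ : ∀ {X B B′} (g : B ⇒ B′) → τʳ X B′ ∘ (id ⊗₁ g) ≡ F₁ (id ⊗₁ g) ∘ τʳ X B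
  τʳ-natʳ g = trans (refl⟩∘⟨ cong (_⊗₁ g) (sym F-id)) (τʳ-nat id g)

  τʳ-η : ∀ X Y → τʳ X Y ∘ (η X ⊗₁ id) ≡ η (X ⊗₀ Y)
  τʳ-η X Y = begin
    (F₁ γ ∘ τ Y X ∘ γ) ∘ (η X ⊗₁ id)   ≡⟨ trans assoc (refl⟩∘⟨ assoc) ⟩
    F₁ γ ∘ τ Y X ∘ γ ∘ (η X ⊗₁ id)     ≡⟨ refl⟩∘⟨ refl⟩∘⟨ γ-nat ⟩
    F₁ γ ∘ τ Y X ∘ (id ⊗₁ η X) ∘ γ     ≡⟨ refl⟩∘⟨ pullˡ (τ-η Y X) ⟩
    F₁ γ ∘ η (Y ⊗₀ X) ∘ γ              ≡⟨ pullˡ (sym (η-nat γ)) ⟩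
    (η (X ⊗₀ Y) ∘ γ) ∘ γ               ≡⟨ trans assoc (refl⟩∘⟨ γ-inv) ⟩
    η (X ⊗₀ Y) ∘ id                    ≡⟨ identityʳ ⟩
    η (X ⊗₀ Y)                         ∎

  τʳ-extend : ∀ {A X Y} (f : A ⇒ T₀ X) →
              τʳ X Y ∘ (extend f ⊗₁ id) ≡ extend (τʳ X Y ∘ (f ⊗₁ id)) ∘ τʳ A Y
  τʳ-extend {A} {X} {Y} f = begin
    (F₁ γ ∘ τ Y X ∘ γ) ∘ (extend f ⊗₁ id)                    ≡⟨ trans assoc (refl⟩∘⟨ assoc) ⟩
    F₁ γ ∘ τ Y X ∘ γ ∘ (extend f ⊗₁ id)                      ≡⟨ refl⟩∘⟨ refl⟩∘⟨ γ-nat ⟩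
    F₁ γ ∘ τ Y X ∘ (id ⊗₁ extend f) ∘ γ                      ≡⟨ refl⟩∘⟨ pullˡ (τ-extend f) ⟩
    F₁ γ ∘ (extend (τ Y X ∘ (id ⊗₁ f)) ∘ τ Y A) ∘ γ          ≡⟨ refl⟩∘⟨ assoc ⟩
    F₁ γ ∘ extend (τ Y X ∘ (id ⊗₁ f)) ∘ τ Y A ∘ γ            ≡⟨ pullˡ (F₁∘extend γ _) ⟩
    extend (F₁ γ ∘ τ Y X ∘ (id ⊗₁ f)) ∘ τ Y A ∘ γ            ≡⟨ cong extend unswap ⟩∘⟨refl ⟩
    extend ((τʳ X Y ∘ (f ⊗₁ id)) ∘ γ) ∘ τ Y A ∘ γ            ≡⟨ sym (extend∘F₁ _ γ) ⟩∘⟨refl ⟩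
    (extend (τʳ X Y ∘ (f ⊗₁ id)) ∘ F₁ γ) ∘ τ Y A ∘ γ         ≡⟨ assoc ⟩
    extend (τʳ X Y ∘ (f ⊗₁ id)) ∘ τʳ A Y                     ∎
    where
    unswap : F₁ γ ∘ τ Y X ∘ (id ⊗₁ f) ≡ (τʳ X Y ∘ (f ⊗₁ id)) ∘ γ
    unswap = sym (begin
      ((F₁ γ ∘ τ Y X ∘ γ) ∘ (f ⊗₁ id)) ∘ γ   ≡⟨ trans assoc (trans assoc (refl⟩∘⟨ assoc)) ⟩
      F₁ γ ∘ τ Y X ∘ γ ∘ (f ⊗₁ id) ∘ γ       ≡⟨ refl⟩∘⟨ refl⟩∘⟨ pullˡ γ-nat ⟩
      F₁ γ ∘ τ Y X ∘ ((id ⊗₁ f) ∘ γ) ∘ γ     ≡⟨ refl⟩∘⟨ refl⟩∘⟨ trans assoc (refl⟩∘⟨ γ-inv) ⟩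
      F₁ γ ∘ τ Y X ∘ (id ⊗₁ f) ∘ id          ≡⟨ refl⟩∘⟨ refl⟩∘⟨ identityʳ ⟩
      F₁ γ ∘ τ Y X ∘ (id ⊗₁ f)               ∎)

  τ-τʳ-α : ∀ X Y W → F₁ α⇒ ∘ τʳ (X ⊗₀ Y) W ∘ (τ X Y ⊗₁ id) ≡ τ X (Y ⊗₀ W) ∘ (id ⊗₁ τʳ Y W) ∘ α⇒
  τ-τʳ-α X Y W = trans lhs (sym rhs)
    where
    common : ((X ⊗₀ T₀ Y) ⊗₀ W) ⇒ T₀ (X ⊗₀ (Y ⊗₀ W))
    common = F₁ (id ⊗₁ γ) ∘ F₁ α⇒ ∘ τ (X ⊗₀ W) Y ∘ α⇐ ∘ (id ⊗₁ γ {T₀ Y} {W}) ∘ α⇒ {X} {T₀ Y} {W}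

    lhs : F₁ α⇒ ∘ τʳ (X ⊗₀ Y) W ∘ (τ X Y ⊗₁ id) ≡ common
    lhs = begin
      F₁ α⇒ ∘ (F₁ γ ∘ τ W (X ⊗₀ Y) ∘ γ) ∘ (τ X Y ⊗₁ id)            ≡⟨ refl⟩∘⟨ trans assoc (refl⟩∘⟨ assoc) ⟩
      F₁ α⇒ ∘ F₁ γ ∘ τ W (X ⊗₀ Y) ∘ γ ∘ (τ X Y ⊗₁ id)              ≡⟨ refl⟩∘⟨ refl⟩∘⟨ refl⟩∘⟨ γ-nat ⟩
      F₁ α⇒ ∘ F₁ γ ∘ τ W (X ⊗₀ Y) ∘ (id ⊗₁ τ X Y) ∘ γ              ≡⟨ refl⟩∘⟨ refl⟩∘⟨ pullˡ (τ-α⁻¹ W X Y) ⟩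
      F₁ α⇒ ∘ F₁ γ ∘ (F₁ α⇒ ∘ τ (W ⊗₀ X) Y ∘ α⇐) ∘ γ               ≡⟨ refl⟩∘⟨ refl⟩∘⟨ trans assoc (refl⟩∘⟨ assoc) ⟩
      F₁ α⇒ ∘ F₁ γ ∘ F₁ α⇒ ∘ τ (W ⊗₀ X) Y ∘ α⇐ ∘ γ                 ≡⟨ refl⟩∘⟨ pullˡ (sym F-∘) ⟩
      F₁ α⇒ ∘ F₁ (γ ∘ α⇒) ∘ τ (W ⊗₀ X) Y ∘ α⇐ ∘ γ                  ≡⟨ pullˡ (sym F-∘) ⟩
      F₁ (α⇒ ∘ γ ∘ α⇒) ∘ τ (W ⊗₀ X) Y ∘ α⇐ ∘ γ                     ≡⟨ cong F₁ hexagon ⟩∘⟨refl ⟩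
      F₁ ((id ⊗₁ γ) ∘ α⇒ ∘ (γ ⊗₁ id)) ∘ τ (W ⊗₀ X) Y ∘ α⇐ ∘ γ      ≡⟨ trans F-∘ (refl⟩∘⟨ F-∘) ⟩∘⟨refl ⟩
      (F₁ (id ⊗₁ γ) ∘ F₁ α⇒ ∘ F₁ (γ ⊗₁ id)) ∘ τ (W ⊗₀ X) Y ∘ α⇐ ∘ γ ≡⟨ trans assoc (refl⟩∘⟨ assoc) ⟩
      F₁ (id ⊗₁ γ) ∘ F₁ α⇒ ∘ F₁ (γ ⊗₁ id) ∘ τ (W ⊗₀ X) Y ∘ α⇐ ∘ γ  ≡⟨ refl⟩∘⟨ refl⟩∘⟨ pullˡ (sym (τ-natˡ γ)) ⟩
      F₁ (id ⊗₁ γ) ∘ F₁ α⇒ ∘ (τ (X ⊗₀ W) Y ∘ (γ ⊗₁ id)) ∘ α⇐ ∘ γ  ≡⟨ refl⟩∘⟨ refl⟩∘⟨ assoc ⟩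
      F₁ (id ⊗₁ γ) ∘ F₁ α⇒ ∘ τ (X ⊗₀ W) Y ∘ (γ ⊗₁ id) ∘ α⇐ ∘ γ    ≡⟨ refl⟩∘⟨ refl⟩∘⟨ refl⟩∘⟨ hexagon⁻¹ ⟩
      common                                                        ∎

    rhs : τ X (Y ⊗₀ W) ∘ (id ⊗₁ τʳ Y W) ∘ α⇒ ≡ common
    rhs = begin
      τ X (Y ⊗₀ W) ∘ (id ⊗₁ (F₁ γ ∘ τ W Y ∘ γ)) ∘ α⇒                           ≡⟨ refl⟩∘⟨ trans id⊗-∘ (refl⟩∘⟨ id⊗-∘) ⟩∘⟨refl ⟩
      τ X (Y ⊗₀ W) ∘ ((id ⊗₁ F₁ γ) ∘ (id ⊗₁ τ W Y) ∘ (id ⊗₁ γ)) ∘ α⇒          ≡⟨ refl⟩∘⟨ trans assoc (refl⟩∘⟨ assoc) ⟩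
      τ X (Y ⊗₀ W) ∘ (id ⊗₁ F₁ γ) ∘ (id ⊗₁ τ W Y) ∘ (id ⊗₁ γ) ∘ α⇒            ≡⟨ pullˡ (τ-natʳ γ) ⟩
      (F₁ (id ⊗₁ γ) ∘ τ X (W ⊗₀ Y)) ∘ (id ⊗₁ τ W Y) ∘ (id ⊗₁ γ) ∘ α⇒          ≡⟨ assoc ⟩
      F₁ (id ⊗₁ γ) ∘ τ X (W ⊗₀ Y) ∘ (id ⊗₁ τ W Y) ∘ (id ⊗₁ γ) ∘ α⇒            ≡⟨ refl⟩∘⟨ pullˡ (τ-α⁻¹ X W Y) ⟩
      F₁ (id ⊗₁ γ) ∘ (F₁ α⇒ ∘ τ (X ⊗₀ W) Y ∘ α⇐) ∘ (id ⊗₁ γ) ∘ α⇒             ≡⟨ refl⟩∘⟨ trans assoc (refl⟩∘⟨ assoc) ⟩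
      common                                                                   ∎

  τ-τʳ-α-nat : ∀ {X Y W A} (c : A ⇒ T₀ Y) →
               F₁ α⇒ ∘ τʳ (X ⊗₀ Y) W ∘ ((τ X Y ∘ (id ⊗₁ c)) ⊗₁ id) ≡
               τ X (Y ⊗₀ W) ∘ (id ⊗₁ (τʳ Y W ∘ (c ⊗₁ id))) ∘ α⇒
  τ-τʳ-α-nat {X} {Y} {W} c = begin
    F₁ α⇒ ∘ τʳ (X ⊗₀ Y) W ∘ ((τ X Y ∘ (id ⊗₁ c)) ⊗₁ id)           ≡⟨ refl⟩∘⟨ refl⟩∘⟨ ∘-⊗id ⟩
    F₁ α⇒ ∘ τʳ (X ⊗₀ Y) W ∘ (τ X Y ⊗₁ id) ∘ ((id ⊗₁ c) ⊗₁ id)      ≡⟨ trans (refl⟩∘⟨ sym-assoc) sym-assoc ⟩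
    (F₁ α⇒ ∘ τʳ (X ⊗₀ Y) W ∘ (τ X Y ⊗₁ id)) ∘ ((id ⊗₁ c) ⊗₁ id)    ≡⟨ τ-τʳ-α X Y W ⟩∘⟨refl ⟩
    (τ X (Y ⊗₀ W) ∘ (id ⊗₁ τʳ Y W) ∘ α⇒) ∘ ((id ⊗₁ c) ⊗₁ id)       ≡⟨ trans assoc (refl⟩∘⟨ assoc) ⟩
    τ X (Y ⊗₀ W) ∘ (id ⊗₁ τʳ Y W) ∘ α⇒ ∘ ((id ⊗₁ c) ⊗₁ id)         ≡⟨ refl⟩∘⟨ refl⟩∘⟨ α-nat ⟩
    τ X (Y ⊗₀ W) ∘ (id ⊗₁ τʳ Y W) ∘ (id ⊗₁ (c ⊗₁ id)) ∘ α⇒         ≡⟨ refl⟩∘⟨ pullˡ (sym id⊗-∘) ⟩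
    τ X (Y ⊗₀ W) ∘ (id ⊗₁ (τʳ Y W ∘ (c ⊗₁ id))) ∘ α⇒               ∎

module Centrality {o ℓ} {C : Category o ℓ} (M : SymmetricMonoidal C)
  {T₀ : Category.Obj C → Category.Obj C} (T : StrongMonadOn M T₀) where
  open Category C
  open SymmetricMonoidal M
  open StrongMonadOn T
  open CategoryReasoning C
  open MonoidalProperties M
  open StrongMonadProperties M T
  open ≡-Reasoning

  -- Kleisli pairings of f : A → T X and g : B → T Y: pairˡʳ performs the effect
  -- of f first, pairʳˡ that of g first.
  pairʳˡ pairˡʳ : ∀ {A B X Y} → A ⇒ T₀ X → B ⇒ T₀ Y → (A ⊗₀ B) ⇒ T₀ (X ⊗₀ Y)
  pairʳˡ {A} {B} {X} {Y} f g = extend (τʳ X Y ∘ (f ⊗₁ id)) ∘ τ A Y ∘ (id ⊗₁ g)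
  pairˡʳ {A} {B} {X} {Y} f g = extend (τ X Y ∘ (id ⊗₁ g)) ∘ τʳ X B ∘ (f ⊗₁ id)

  Central : ∀ {A X} → A ⇒ T₀ X → Set (o ⊔ ℓ)
  Central f = ∀ {B Y} (g : B ⇒ T₀ Y) → pairʳˡ f g ≡ pairˡʳ f g

  pairʳˡ-id : ∀ {A X} (f : A ⇒ T₀ X) Y →
              μ (X ⊗₀ Y) ∘ F₁ (τʳ X Y) ∘ τ (T₀ X) Y ∘ (f ⊗₁ id {T₀ Y}) ≡ pairʳˡ f (id {T₀ Y})
  pairʳˡ-id {A} {X} f Y = begin
    μ (X ⊗₀ Y) ∘ F₁ (τʳ X Y) ∘ τ (T₀ X) Y ∘ (f ⊗₁ id)   ≡⟨ refl⟩∘⟨ refl⟩∘⟨ τ-natˡ f ⟩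
    μ (X ⊗₀ Y) ∘ F₁ (τʳ X Y) ∘ F₁ (f ⊗₁ id) ∘ τ A Y     ≡⟨ refl⟩∘⟨ pullˡ (sym F-∘) ⟩
    μ (X ⊗₀ Y) ∘ F₁ (τʳ X Y ∘ (f ⊗₁ id)) ∘ τ A Y        ≡⟨ sym-assoc ⟩
    extend (τʳ X Y ∘ (f ⊗₁ id)) ∘ τ A Y                 ≡⟨ refl⟩∘⟨ sym ∘-id⊗id ⟩
    pairʳˡ f id                                         ∎

  pairˡʳ-id : ∀ {A X} (f : A ⇒ T₀ X) Y →
              μ (X ⊗₀ Y) ∘ F₁ (τ X Y) ∘ τʳ X (T₀ Y) ∘ (f ⊗₁ id {T₀ Y}) ≡ pairˡʳ f (id {T₀ Y})
  pairˡʳ-id f Y = trans sym-assoc (cong extend (sym ∘-id⊗id) ⟩∘⟨refl)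

  pairʳˡ-∘id⊗ : ∀ {A B X Y} (f : A ⇒ T₀ X) (g : B ⇒ T₀ Y) → pairʳˡ f g ≡ pairʳˡ f id ∘ (id ⊗₁ g)
  pairʳˡ-∘id⊗ f g = sym (trans assoc (refl⟩∘⟨ trans assoc (refl⟩∘⟨ id⊗id-∘)))

  pairˡʳ-∘id⊗ : ∀ {A B X Y} (f : A ⇒ T₀ X) (g : B ⇒ T₀ Y) → pairˡʳ f g ≡ pairˡʳ f id ∘ (id ⊗₁ g)
  pairˡʳ-∘id⊗ {A} {B} {X} {Y} f g = sym (begin
    (extend (τ X Y ∘ (id ⊗₁ id)) ∘ τʳ X (T₀ Y) ∘ (f ⊗₁ id)) ∘ (id ⊗₁ g)   ≡⟨ trans assoc (refl⟩∘⟨ assoc) ⟩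
    extend (τ X Y ∘ (id ⊗₁ id)) ∘ τʳ X (T₀ Y) ∘ (f ⊗₁ id) ∘ (id ⊗₁ g)     ≡⟨ cong extend ∘-id⊗id ⟩∘⟨ refl⟩∘⟨ ⊗-interchange ⟩
    extend (τ X Y) ∘ τʳ X (T₀ Y) ∘ (id ⊗₁ g) ∘ (f ⊗₁ id)                  ≡⟨ refl⟩∘⟨ pullˡ (τʳ-natʳ g) ⟩
    extend (τ X Y) ∘ (F₁ (id ⊗₁ g) ∘ τʳ X B) ∘ (f ⊗₁ id)                  ≡⟨ refl⟩∘⟨ assoc ⟩
    extend (τ X Y) ∘ F₁ (id ⊗₁ g) ∘ τʳ X B ∘ (f ⊗₁ id)                    ≡⟨ pullˡ (extend∘F₁ _ _) ⟩
    pairˡʳ f g                                                            ∎)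

  -- IsCentral only tests g = id; general g factor through it.
  IsCentral⇒Central : ∀ {A X} {f : A ⇒ T₀ X} → IsCentral M T X f → Central f
  IsCentral⇒Central {f = f} c g = begin
    pairʳˡ f g               ≡⟨ pairʳˡ-∘id⊗ f g ⟩
    pairʳˡ f id ∘ (id ⊗₁ g)  ≡⟨ trans (sym (pairʳˡ-id f _)) (trans (c _) (pairˡʳ-id f _)) ⟩∘⟨refl ⟩
    pairˡʳ f id ∘ (id ⊗₁ g)  ≡⟨ sym (pairˡʳ-∘id⊗ f g) ⟩
    pairˡʳ f g               ∎

  Central⇒IsCentral : ∀ {A X} {f : A ⇒ T₀ X} → Central f → IsCentral M T X f
  Central⇒IsCentral {f = f} c Y = trans (pairʳˡ-id f Y) (trans (c id) (sym (pairˡʳ-id f Y)))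

  central-∘ : ∀ {A A′ X} {f : A ⇒ T₀ X} → Central f → (k : A′ ⇒ A) → Central (f ∘ k)
  central-∘ {A} {A′} {X} {f} c k {B} {Y} g = begin
    extend (τʳ X Y ∘ ((f ∘ k) ⊗₁ id)) ∘ τ A′ Y ∘ (id ⊗₁ g)               ≡⟨ cong extend (trans (refl⟩∘⟨ ∘-⊗id) sym-assoc) ⟩∘⟨refl ⟩
    extend ((τʳ X Y ∘ (f ⊗₁ id)) ∘ (k ⊗₁ id)) ∘ τ A′ Y ∘ (id ⊗₁ g)       ≡⟨ sym (extend∘F₁ _ _) ⟩∘⟨refl ⟩
    (extend (τʳ X Y ∘ (f ⊗₁ id)) ∘ F₁ (k ⊗₁ id)) ∘ τ A′ Y ∘ (id ⊗₁ g)    ≡⟨ assoc ⟩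
    extend (τʳ X Y ∘ (f ⊗₁ id)) ∘ F₁ (k ⊗₁ id) ∘ τ A′ Y ∘ (id ⊗₁ g)      ≡⟨ refl⟩∘⟨ pullˡ (sym (τ-natˡ k)) ⟩
    extend (τʳ X Y ∘ (f ⊗₁ id)) ∘ (τ A Y ∘ (k ⊗₁ id)) ∘ (id ⊗₁ g)        ≡⟨ refl⟩∘⟨ trans assoc (refl⟩∘⟨ ⊗-interchange) ⟩
    extend (τʳ X Y ∘ (f ⊗₁ id)) ∘ τ A Y ∘ (id ⊗₁ g) ∘ (k ⊗₁ id)          ≡⟨ trans (refl⟩∘⟨ sym-assoc) sym-assoc ⟩
    pairʳˡ f g ∘ (k ⊗₁ id)                                               ≡⟨ c g ⟩∘⟨refl ⟩
    (extend (τ X Y ∘ (id ⊗₁ g)) ∘ τʳ X B ∘ (f ⊗₁ id)) ∘ (k ⊗₁ id)        ≡⟨ trans assoc (refl⟩∘⟨ assoc) ⟩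
    extend (τ X Y ∘ (id ⊗₁ g)) ∘ τʳ X B ∘ (f ⊗₁ id) ∘ (k ⊗₁ id)          ≡⟨ refl⟩∘⟨ refl⟩∘⟨ sym ∘-⊗id ⟩
    pairˡʳ (f ∘ k) g                                                     ∎

  central-η : ∀ X → Central (η X)
  central-η X {B} {Y} g = begin
    extend (τʳ X Y ∘ (η X ⊗₁ id)) ∘ τ X Y ∘ (id ⊗₁ g)   ≡⟨ trans (cong extend (τʳ-η X Y)) extend-η ⟩∘⟨refl ⟩
    id ∘ τ X Y ∘ (id ⊗₁ g)                              ≡⟨ identityˡ ⟩
    τ X Y ∘ (id ⊗₁ g)                                   ≡⟨ sym (extend∘η _) ⟩
    extend (τ X Y ∘ (id ⊗₁ g)) ∘ η (X ⊗₀ B)             ≡⟨ refl⟩∘⟨ sym (τʳ-η X B) ⟩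
    pairˡʳ (η X) g                                      ∎

  central-extend : ∀ {A B′ X} {f : A ⇒ T₀ B′} {h : B′ ⇒ T₀ X} →
                   Central f → Central h → Central (extend h ∘ f)
  central-extend {A} {B′} {X} {f} {h} cf ch {B} {Y} g = trans pairʳˡ-side (sym pairˡʳ-side)
    where
    τʳ-extend∘ : ∀ {Z} → τʳ X Z ∘ ((extend h ∘ f) ⊗₁ id) ≡
                         extend (τʳ X Z ∘ (h ⊗₁ id)) ∘ τʳ B′ Z ∘ (f ⊗₁ id)
    τʳ-extend∘ = trans (refl⟩∘⟨ ∘-⊗id) (trans (pullˡ (τʳ-extend h)) assoc)

    pairʳˡ-side : pairʳˡ (extend h ∘ f) g ≡ extend (pairˡʳ h g) ∘ τʳ B′ B ∘ (f ⊗₁ id)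
    pairʳˡ-side = begin
      extend (τʳ X Y ∘ ((extend h ∘ f) ⊗₁ id)) ∘ τ A Y ∘ (id ⊗₁ g)       ≡⟨ cong extend τʳ-extend∘ ⟩∘⟨refl ⟩
      extend (extend (τʳ X Y ∘ (h ⊗₁ id)) ∘ τʳ B′ Y ∘ (f ⊗₁ id)) ∘ τ A Y ∘ (id ⊗₁ g)
                                                                         ≡⟨ trans (sym (extend∘extend _ _) ⟩∘⟨refl) assoc ⟩
      extend (τʳ X Y ∘ (h ⊗₁ id)) ∘ pairʳˡ f g                           ≡⟨ refl⟩∘⟨ cf g ⟩
      extend (τʳ X Y ∘ (h ⊗₁ id)) ∘ pairˡʳ f g                           ≡⟨ pullˡ (extend∘extend _ _) ⟩
      extend (pairʳˡ h g) ∘ τʳ B′ B ∘ (f ⊗₁ id)                          ≡⟨ cong extend (ch g) ⟩∘⟨refl ⟩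
      extend (pairˡʳ h g) ∘ τʳ B′ B ∘ (f ⊗₁ id)                          ∎

    pairˡʳ-side : pairˡʳ (extend h ∘ f) g ≡ extend (pairˡʳ h g) ∘ τʳ B′ B ∘ (f ⊗₁ id)
    pairˡʳ-side = trans (refl⟩∘⟨ τʳ-extend∘) (pullˡ (extend∘extend _ _))

  -- Both pairings commute with the associativity of the strength; F₁ α⇒ is then cancelled.
  central-τ : ∀ {X Y A} {c : A ⇒ T₀ Y} → Central c → Central (τ X Y ∘ (id ⊗₁ c))
  central-τ {X} {Y} {A} {c} cc {B} {W} g = begin
    pairʳˡ f g                                     ≡⟨ sym (cancelˡ F₁α⇐∘F₁α⇒) ⟩
    F₁ α⇐ ∘ F₁ α⇒ ∘ pairʳˡ f g                     ≡⟨ refl⟩∘⟨ α-pairʳˡ ⟩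
    F₁ α⇐ ∘ τ X (Y ⊗₀ W) ∘ (id ⊗₁ pairʳˡ c g) ∘ α⇒ ≡⟨ refl⟩∘⟨ refl⟩∘⟨ cong (id ⊗₁_) (cc g) ⟩∘⟨refl ⟩
    F₁ α⇐ ∘ τ X (Y ⊗₀ W) ∘ (id ⊗₁ pairˡʳ c g) ∘ α⇒ ≡⟨ refl⟩∘⟨ sym α-pairˡʳ ⟩
    F₁ α⇐ ∘ F₁ α⇒ ∘ pairˡʳ f g                     ≡⟨ cancelˡ F₁α⇐∘F₁α⇒ ⟩
    pairˡʳ f g                                     ∎
    where
    f = τ X Y ∘ (id ⊗₁ c)

    F₁α⇐∘F₁α⇒ : ∀ {U V Z} → F₁ (α⇐ {U} {V} {Z}) ∘ F₁ α⇒ ≡ id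
    F₁α⇐∘F₁α⇒ = trans (sym F-∘) (trans (cong F₁ α-iso₂) F-id)

    α-pairʳˡ : F₁ α⇒ ∘ pairʳˡ f g ≡ τ X (Y ⊗₀ W) ∘ (id ⊗₁ pairʳˡ c g) ∘ α⇒
    α-pairʳˡ = begin
      F₁ α⇒ ∘ extend (τʳ (X ⊗₀ Y) W ∘ (f ⊗₁ id)) ∘ τ (X ⊗₀ A) W ∘ (id ⊗₁ g)
        ≡⟨ pullˡ (F₁∘extend _ _) ⟩
      extend (F₁ α⇒ ∘ τʳ (X ⊗₀ Y) W ∘ (f ⊗₁ id)) ∘ τ (X ⊗₀ A) W ∘ (id ⊗₁ g)
        ≡⟨ cong extend (trans (τ-τʳ-α-nat c) sym-assoc) ⟩∘⟨refl ⟩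
      extend ((τ X (Y ⊗₀ W) ∘ (id ⊗₁ k)) ∘ α⇒) ∘ τ (X ⊗₀ A) W ∘ (id ⊗₁ g)
        ≡⟨ trans (sym (extend∘F₁ _ _) ⟩∘⟨refl) assoc ⟩
      extend (τ X (Y ⊗₀ W) ∘ (id ⊗₁ k)) ∘ F₁ α⇒ ∘ τ (X ⊗₀ A) W ∘ (id ⊗₁ g)
        ≡⟨ refl⟩∘⟨ τ-α-nat g ⟩
      extend (τ X (Y ⊗₀ W) ∘ (id ⊗₁ k)) ∘ τ X (A ⊗₀ W) ∘ (id ⊗₁ (τ A W ∘ (id ⊗₁ g))) ∘ α⇒
        ≡⟨ trans (pullˡ (sym (τ-extend k))) assoc ⟩
      τ X (Y ⊗₀ W) ∘ (id ⊗₁ extend k) ∘ (id ⊗₁ (τ A W ∘ (id ⊗₁ g))) ∘ α⇒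
        ≡⟨ refl⟩∘⟨ pullˡ (sym id⊗-∘) ⟩
      τ X (Y ⊗₀ W) ∘ (id ⊗₁ pairʳˡ c g) ∘ α⇒
        ∎
      where k = τʳ Y W ∘ (c ⊗₁ id)

    α-pairˡʳ : F₁ α⇒ ∘ pairˡʳ f g ≡ τ X (Y ⊗₀ W) ∘ (id ⊗₁ pairˡʳ c g) ∘ α⇒
    α-pairˡʳ = begin
      F₁ α⇒ ∘ extend (τ (X ⊗₀ Y) W ∘ (id ⊗₁ g)) ∘ τʳ (X ⊗₀ Y) B ∘ (f ⊗₁ id)
        ≡⟨ pullˡ (F₁∘extend _ _) ⟩
      extend (F₁ α⇒ ∘ τ (X ⊗₀ Y) W ∘ (id ⊗₁ g)) ∘ τʳ (X ⊗₀ Y) B ∘ (f ⊗₁ id)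
        ≡⟨ cong extend (trans (τ-α-nat g) sym-assoc) ⟩∘⟨refl ⟩
      extend ((τ X (Y ⊗₀ W) ∘ (id ⊗₁ k)) ∘ α⇒) ∘ τʳ (X ⊗₀ Y) B ∘ (f ⊗₁ id)
        ≡⟨ trans (sym (extend∘F₁ _ _) ⟩∘⟨refl) assoc ⟩
      extend (τ X (Y ⊗₀ W) ∘ (id ⊗₁ k)) ∘ F₁ α⇒ ∘ τʳ (X ⊗₀ Y) B ∘ (f ⊗₁ id)
        ≡⟨ refl⟩∘⟨ τ-τʳ-α-nat c ⟩
      extend (τ X (Y ⊗₀ W) ∘ (id ⊗₁ k)) ∘ τ X (Y ⊗₀ B) ∘ (id ⊗₁ (τʳ Y B ∘ (c ⊗₁ id))) ∘ α⇒
        ≡⟨ trans (pullˡ (sym (τ-extend k))) assoc ⟩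
      τ X (Y ⊗₀ W) ∘ (id ⊗₁ extend k) ∘ (id ⊗₁ (τʳ Y B ∘ (c ⊗₁ id))) ∘ α⇒
        ≡⟨ refl⟩∘⟨ pullˡ (sym id⊗-∘) ⟩
      τ X (Y ⊗₀ W) ∘ (id ⊗₁ pairˡʳ c g) ∘ α⇒
        ∎
      where k = τ Y W ∘ (id ⊗₁ g)

module Centre {o ℓ} {C : Category o ℓ} (M : SymmetricMonoidal C)
  {T₀ : Category.Obj C → Category.Obj C} (T : StrongMonadOn M T₀)
  (centralisable : Centralisable M T) where
  open Category C
  open SymmetricMonoidal M
  open StrongMonadOn T
  open CategoryReasoning C
  open MonoidalProperties M
  open StrongMonadProperties M T
  open Centrality M T
  open ≡-Reasoning

  Z₀ : Obj → Obj
  Z₀ X = CentralCone.obj (proj₁ (centralisable X))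

  ι : ∀ X → Z₀ X ⇒ T₀ X
  ι X = CentralCone.arr (proj₁ (centralisable X))

  ι-central : ∀ X → Central (ι X)
  ι-central X = IsCentral⇒Central (CentralCone.central (proj₁ (centralisable X)))

  private
    coneOf : ∀ {W X} (h : W ⇒ T₀ X) → Central h → CentralCone M T X
    coneOf {W} h c = record { obj = W ; arr = h ; central = Central⇒IsCentral c }

    universal : ∀ {W X} (h : W ⇒ T₀ X) (c : Central h) →
                Σ (W ⇒ Z₀ X) λ φ → (ι X ∘ φ ≡ h) × (∀ ψ → ι X ∘ ψ ≡ h → ψ ≡ φ)
    universal {X = X} h c = proj₂ (centralisable X) (coneOf h c)

  factor : ∀ {W X} (h : W ⇒ T₀ X) → Central h → W ⇒ Z₀ X
  factor h c = proj₁ (universal h c)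

  ι∘factor : ∀ {W X} (h : W ⇒ T₀ X) (c : Central h) → ι X ∘ factor h c ≡ h
  ι∘factor h c = proj₁ (proj₂ (universal h c))

  -- a and b are both factorisations of the central cone ι ∘ b.
  ι-cancel : ∀ {W X} {a b : W ⇒ Z₀ X} → ι X ∘ a ≡ ι X ∘ b → a ≡ b
  ι-cancel {X = X} {a} {b} p = trans (unique a p) (sym (unique b refl))
    where unique = proj₂ (proj₂ (universal (ι X ∘ b) (central-∘ (ι-central X) b)))

  central-F₁∘ι : ∀ {X Y} (f : X ⇒ Y) → Central (F₁ f ∘ ι X)
  central-F₁∘ι {X} {Y} f =
    subst (λ h → Central (h ∘ ι X)) (extend-η∘ f) (central-extend (ι-central X) (central-∘ (central-η Y) f))

  -- The structure maps are determined by their composites with ι; keeping them opaque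
  -- stops the typechecker from unfolding the (large) centrality proofs inside them.
  opaque
    F₁ᶻ : ∀ {X Y} → X ⇒ Y → Z₀ X ⇒ Z₀ Y
    F₁ᶻ f = factor (F₁ f ∘ ι _) (central-F₁∘ι f)

    ι-F₁ᶻ : ∀ {X Y} (f : X ⇒ Y) → ι Y ∘ F₁ᶻ f ≡ F₁ f ∘ ι X
    ι-F₁ᶻ f = ι∘factor _ (central-F₁∘ι f)

    ηᶻ : ∀ X → X ⇒ Z₀ X
    ηᶻ X = factor (η X) (central-η X)

    ι-ηᶻ : ∀ X → ι X ∘ ηᶻ X ≡ η X
    ι-ηᶻ X = ι∘factor _ (central-η X)

    μᶻ : ∀ X → Z₀ (Z₀ X) ⇒ Z₀ X
    μᶻ X = factor (extend (ι X) ∘ ι (Z₀ X)) (central-extend (ι-central (Z₀ X)) (ι-central X))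

    ι-μᶻ : ∀ X → ι X ∘ μᶻ X ≡ extend (ι X) ∘ ι (Z₀ X)
    ι-μᶻ X = ι∘factor _ (central-extend (ι-central (Z₀ X)) (ι-central X))

    τᶻ : ∀ X Y → (X ⊗₀ Z₀ Y) ⇒ Z₀ (X ⊗₀ Y)
    τᶻ X Y = factor (τ X Y ∘ (id ⊗₁ ι Y)) (central-τ (ι-central Y))

    ι-τᶻ : ∀ X Y → ι (X ⊗₀ Y) ∘ τᶻ X Y ≡ τ X Y ∘ (id ⊗₁ ι Y)
    ι-τᶻ X Y = ι∘factor _ (central-τ (ι-central Y))

  ι-μᶻ-F₁ᶻ-∘ : ∀ {X A W} (a : A ⇒ Z₀ X) (b : W ⇒ Z₀ A) →
             ι X ∘ μᶻ X ∘ F₁ᶻ a ∘ b ≡ extend (ι X ∘ a) ∘ ι A ∘ b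
  ι-μᶻ-F₁ᶻ-∘ {X} {A} a b = begin
    ι X ∘ μᶻ X ∘ F₁ᶻ a ∘ b                 ≡⟨ pullˡ (ι-μᶻ X) ⟩
    (extend (ι X) ∘ ι (Z₀ X)) ∘ F₁ᶻ a ∘ b  ≡⟨ assoc ⟩
    extend (ι X) ∘ ι (Z₀ X) ∘ F₁ᶻ a ∘ b    ≡⟨ refl⟩∘⟨ pullˡ (ι-F₁ᶻ a) ⟩
    extend (ι X) ∘ (F₁ a ∘ ι A) ∘ b        ≡⟨ refl⟩∘⟨ assoc ⟩
    extend (ι X) ∘ F₁ a ∘ ι A ∘ b          ≡⟨ pullˡ (extend∘F₁ _ _) ⟩
    extend (ι X ∘ a) ∘ ι A ∘ b             ∎

  ι-μᶻ-F₁ᶻ : ∀ {X A} (a : A ⇒ Z₀ X) → ι X ∘ μᶻ X ∘ F₁ᶻ a ≡ extend (ι X ∘ a) ∘ ι A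
  ι-μᶻ-F₁ᶻ {X} {A} a = begin
    ι X ∘ μᶻ X ∘ F₁ᶻ a          ≡⟨ refl⟩∘⟨ refl⟩∘⟨ sym identityʳ ⟩
    ι X ∘ μᶻ X ∘ F₁ᶻ a ∘ id     ≡⟨ ι-μᶻ-F₁ᶻ-∘ a id ⟩
    extend (ι X ∘ a) ∘ ι A ∘ id ≡⟨ refl⟩∘⟨ identityʳ ⟩
    extend (ι X ∘ a) ∘ ι A      ∎

  F₁ᶻ-id : ∀ {X} → F₁ᶻ (id {X}) ≡ id
  F₁ᶻ-id = ι-cancel (trans (ι-F₁ᶻ id) (trans (F-id ⟩∘⟨refl) (trans identityˡ (sym identityʳ))))

  F₁ᶻ-∘ : ∀ {X Y W} {f : X ⇒ Y} {g : Y ⇒ W} → F₁ᶻ (g ∘ f) ≡ F₁ᶻ g ∘ F₁ᶻ f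
  F₁ᶻ-∘ {X} {Y} {W} {f} {g} = ι-cancel (begin
    ι W ∘ F₁ᶻ (g ∘ f)       ≡⟨ ι-F₁ᶻ _ ⟩
    F₁ (g ∘ f) ∘ ι X        ≡⟨ trans (F-∘ ⟩∘⟨refl) assoc ⟩
    F₁ g ∘ F₁ f ∘ ι X       ≡⟨ refl⟩∘⟨ sym (ι-F₁ᶻ f) ⟩
    F₁ g ∘ ι Y ∘ F₁ᶻ f      ≡⟨ trans (pullˡ (sym (ι-F₁ᶻ g))) assoc ⟩
    ι W ∘ F₁ᶻ g ∘ F₁ᶻ f     ∎)

  ηᶻ-nat : ∀ {X Y} (f : X ⇒ Y) → ηᶻ Y ∘ f ≡ F₁ᶻ f ∘ ηᶻ X
  ηᶻ-nat {X} {Y} f = ι-cancel (begin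
    ι Y ∘ ηᶻ Y ∘ f      ≡⟨ pullˡ (ι-ηᶻ Y) ⟩
    η Y ∘ f             ≡⟨ η-nat f ⟩
    F₁ f ∘ η X          ≡⟨ refl⟩∘⟨ sym (ι-ηᶻ X) ⟩
    F₁ f ∘ ι X ∘ ηᶻ X   ≡⟨ trans (pullˡ (sym (ι-F₁ᶻ f))) assoc ⟩
    ι Y ∘ F₁ᶻ f ∘ ηᶻ X  ∎)

  μᶻ-nat : ∀ {X Y} (f : X ⇒ Y) → μᶻ Y ∘ F₁ᶻ (F₁ᶻ f) ≡ F₁ᶻ f ∘ μᶻ X
  μᶻ-nat {X} {Y} f = ι-cancel (begin
    ι Y ∘ μᶻ Y ∘ F₁ᶻ (F₁ᶻ f)          ≡⟨ ι-μᶻ-F₁ᶻ (F₁ᶻ f) ⟩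
    extend (ι Y ∘ F₁ᶻ f) ∘ ι (Z₀ X)   ≡⟨ cong extend (ι-F₁ᶻ f) ⟩∘⟨refl ⟩
    extend (F₁ f ∘ ι X) ∘ ι (Z₀ X)    ≡⟨ trans (sym (F₁∘extend _ _) ⟩∘⟨refl) assoc ⟩
    F₁ f ∘ extend (ι X) ∘ ι (Z₀ X)    ≡⟨ refl⟩∘⟨ sym (ι-μᶻ X) ⟩
    F₁ f ∘ ι X ∘ μᶻ X                 ≡⟨ trans (pullˡ (sym (ι-F₁ᶻ f))) assoc ⟩
    ι Y ∘ F₁ᶻ f ∘ μᶻ X                ∎)

  μᶻ-assoc : ∀ X → μᶻ X ∘ F₁ᶻ (μᶻ X) ≡ μᶻ X ∘ μᶻ (Z₀ X)
  μᶻ-assoc X = ι-cancel (begin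
    ι X ∘ μᶻ X ∘ F₁ᶻ (μᶻ X)                           ≡⟨ ι-μᶻ-F₁ᶻ (μᶻ X) ⟩
    extend (ι X ∘ μᶻ X) ∘ ι (Z₀ (Z₀ X))               ≡⟨ cong extend (ι-μᶻ X) ⟩∘⟨refl ⟩
    extend (extend (ι X) ∘ ι (Z₀ X)) ∘ ι (Z₀ (Z₀ X))  ≡⟨ trans (sym (extend∘extend _ _) ⟩∘⟨refl) assoc ⟩
    extend (ι X) ∘ extend (ι (Z₀ X)) ∘ ι (Z₀ (Z₀ X))  ≡⟨ refl⟩∘⟨ sym (ι-μᶻ (Z₀ X)) ⟩
    extend (ι X) ∘ ι (Z₀ X) ∘ μᶻ (Z₀ X)               ≡⟨ trans (pullˡ (sym (ι-μᶻ X))) assoc ⟩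
    ι X ∘ μᶻ X ∘ μᶻ (Z₀ X)                            ∎)

  μᶻ-unitˡ : ∀ X → μᶻ X ∘ F₁ᶻ (ηᶻ X) ≡ id
  μᶻ-unitˡ X = ι-cancel (begin
    ι X ∘ μᶻ X ∘ F₁ᶻ (ηᶻ X)     ≡⟨ ι-μᶻ-F₁ᶻ (ηᶻ X) ⟩
    extend (ι X ∘ ηᶻ X) ∘ ι X   ≡⟨ trans (cong extend (ι-ηᶻ X)) extend-η ⟩∘⟨refl ⟩
    id ∘ ι X                    ≡⟨ trans identityˡ (sym identityʳ) ⟩
    ι X ∘ id                    ∎)

  μᶻ-unitʳ : ∀ X → μᶻ X ∘ ηᶻ (Z₀ X) ≡ id
  μᶻ-unitʳ X = ι-cancel (begin
    ι X ∘ μᶻ X ∘ ηᶻ (Z₀ X)                  ≡⟨ pullˡ (ι-μᶻ X) ⟩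
    (extend (ι X) ∘ ι (Z₀ X)) ∘ ηᶻ (Z₀ X)   ≡⟨ trans assoc (refl⟩∘⟨ ι-ηᶻ (Z₀ X)) ⟩
    extend (ι X) ∘ η (Z₀ X)                 ≡⟨ extend∘η _ ⟩
    ι X                                     ≡⟨ sym identityʳ ⟩
    ι X ∘ id                                ∎)

  τᶻ-nat : ∀ {X X′ Y Y′} (f : X ⇒ X′) (g : Y ⇒ Y′) →
           τᶻ X′ Y′ ∘ (f ⊗₁ F₁ᶻ g) ≡ F₁ᶻ (f ⊗₁ g) ∘ τᶻ X Y
  τᶻ-nat {X} {X′} {Y} {Y′} f g = ι-cancel (begin
    ι (X′ ⊗₀ Y′) ∘ τᶻ X′ Y′ ∘ (f ⊗₁ F₁ᶻ g)         ≡⟨ trans (pullˡ (ι-τᶻ X′ Y′)) assoc ⟩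
    τ X′ Y′ ∘ (id ⊗₁ ι Y′) ∘ (f ⊗₁ F₁ᶻ g)          ≡⟨ refl⟩∘⟨ sym ⊗-∘ ⟩
    τ X′ Y′ ∘ ((id ∘ f) ⊗₁ (ι Y′ ∘ F₁ᶻ g))         ≡⟨ refl⟩∘⟨ cong₂ _⊗₁_ (trans identityˡ (sym identityʳ)) (ι-F₁ᶻ g) ⟩
    τ X′ Y′ ∘ ((f ∘ id) ⊗₁ (F₁ g ∘ ι Y))           ≡⟨ refl⟩∘⟨ ⊗-∘ ⟩
    τ X′ Y′ ∘ (f ⊗₁ F₁ g) ∘ (id ⊗₁ ι Y)            ≡⟨ trans (pullˡ (τ-nat f g)) assoc ⟩
    F₁ (f ⊗₁ g) ∘ τ X Y ∘ (id ⊗₁ ι Y)              ≡⟨ refl⟩∘⟨ sym (ι-τᶻ X Y) ⟩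
    F₁ (f ⊗₁ g) ∘ ι (X ⊗₀ Y) ∘ τᶻ X Y              ≡⟨ trans (pullˡ (sym (ι-F₁ᶻ _))) assoc ⟩
    ι (X′ ⊗₀ Y′) ∘ F₁ᶻ (f ⊗₁ g) ∘ τᶻ X Y           ∎)

  τᶻ-λ : ∀ X → F₁ᶻ λ⇒ ∘ τᶻ unit X ≡ λ⇒
  τᶻ-λ X = ι-cancel (begin
    ι X ∘ F₁ᶻ λ⇒ ∘ τᶻ unit X                 ≡⟨ trans (pullˡ (ι-F₁ᶻ λ⇒)) assoc ⟩
    F₁ λ⇒ ∘ ι (unit ⊗₀ X) ∘ τᶻ unit X        ≡⟨ refl⟩∘⟨ ι-τᶻ unit X ⟩
    F₁ λ⇒ ∘ τ unit X ∘ (id ⊗₁ ι X)           ≡⟨ pullˡ (τ-λ X) ⟩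
    λ⇒ ∘ (id ⊗₁ ι X)                         ≡⟨ sym λ-nat ⟩
    ι X ∘ λ⇒                                 ∎)

  τᶻ-α : ∀ X Y W → F₁ᶻ α⇒ ∘ τᶻ (X ⊗₀ Y) W ≡ τᶻ X (Y ⊗₀ W) ∘ (id ⊗₁ τᶻ Y W) ∘ α⇒
  τᶻ-α X Y W = ι-cancel (begin
    ι _ ∘ F₁ᶻ α⇒ ∘ τᶻ (X ⊗₀ Y) W                                 ≡⟨ trans (pullˡ (ι-F₁ᶻ α⇒)) assoc ⟩
    F₁ α⇒ ∘ ι _ ∘ τᶻ (X ⊗₀ Y) W                                  ≡⟨ refl⟩∘⟨ ι-τᶻ _ W ⟩
    F₁ α⇒ ∘ τ (X ⊗₀ Y) W ∘ (id ⊗₁ ι W)                           ≡⟨ τ-α-nat (ι W) ⟩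
    τ X (Y ⊗₀ W) ∘ (id ⊗₁ (τ Y W ∘ (id ⊗₁ ι W))) ∘ α⇒            ≡⟨ refl⟩∘⟨ cong (id ⊗₁_) (sym (ι-τᶻ Y W)) ⟩∘⟨refl ⟩
    τ X (Y ⊗₀ W) ∘ (id ⊗₁ (ι _ ∘ τᶻ Y W)) ∘ α⇒                   ≡⟨ refl⟩∘⟨ trans (id⊗-∘ ⟩∘⟨refl) assoc ⟩
    τ X (Y ⊗₀ W) ∘ (id ⊗₁ ι _) ∘ (id ⊗₁ τᶻ Y W) ∘ α⇒             ≡⟨ trans (pullˡ (sym (ι-τᶻ X (Y ⊗₀ W)))) assoc ⟩
    ι _ ∘ τᶻ X (Y ⊗₀ W) ∘ (id ⊗₁ τᶻ Y W) ∘ α⇒                    ∎)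

  τᶻ-η : ∀ X Y → τᶻ X Y ∘ (id ⊗₁ ηᶻ Y) ≡ ηᶻ (X ⊗₀ Y)
  τᶻ-η X Y = ι-cancel (begin
    ι _ ∘ τᶻ X Y ∘ (id ⊗₁ ηᶻ Y)            ≡⟨ trans (pullˡ (ι-τᶻ X Y)) assoc ⟩
    τ X Y ∘ (id ⊗₁ ι Y) ∘ (id ⊗₁ ηᶻ Y)     ≡⟨ refl⟩∘⟨ trans (sym id⊗-∘) (cong (id ⊗₁_) (ι-ηᶻ Y)) ⟩
    τ X Y ∘ (id ⊗₁ η Y)                    ≡⟨ τ-η X Y ⟩
    η (X ⊗₀ Y)                             ≡⟨ sym (ι-ηᶻ _) ⟩
    ι _ ∘ ηᶻ (X ⊗₀ Y)                      ∎)

  τᶻ-μ : ∀ X Y → τᶻ X Y ∘ (id ⊗₁ μᶻ Y) ≡ μᶻ (X ⊗₀ Y) ∘ F₁ᶻ (τᶻ X Y) ∘ τᶻ X (Z₀ Y)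
  τᶻ-μ X Y = ι-cancel (begin
    ι _ ∘ τᶻ X Y ∘ (id ⊗₁ μᶻ Y)                                           ≡⟨ trans (pullˡ (ι-τᶻ X Y)) assoc ⟩
    τ X Y ∘ (id ⊗₁ ι Y) ∘ (id ⊗₁ μᶻ Y)                                    ≡⟨ refl⟩∘⟨ trans (sym id⊗-∘) (cong (id ⊗₁_) (ι-μᶻ Y)) ⟩
    τ X Y ∘ (id ⊗₁ (extend (ι Y) ∘ ι (Z₀ Y)))                             ≡⟨ refl⟩∘⟨ id⊗-∘ ⟩
    τ X Y ∘ (id ⊗₁ extend (ι Y)) ∘ (id ⊗₁ ι (Z₀ Y))                       ≡⟨ trans (pullˡ (τ-extend (ι Y))) assoc ⟩
    extend (τ X Y ∘ (id ⊗₁ ι Y)) ∘ τ X (Z₀ Y) ∘ (id ⊗₁ ι (Z₀ Y))          ≡⟨ cong extend (sym (ι-τᶻ X Y)) ⟩∘⟨ sym (ι-τᶻ X (Z₀ Y)) ⟩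
    extend (ι _ ∘ τᶻ X Y) ∘ ι _ ∘ τᶻ X (Z₀ Y)                             ≡⟨ sym (ι-μᶻ-F₁ᶻ-∘ (τᶻ X Y) (τᶻ X (Z₀ Y))) ⟩
    ι _ ∘ μᶻ _ ∘ F₁ᶻ (τᶻ X Y) ∘ τᶻ X (Z₀ Y)                               ∎)

  𝒵 : StrongMonadOn M Z₀
  𝒵 = record
    { F₁ = F₁ᶻ ; F-id = F₁ᶻ-id ; F-∘ = F₁ᶻ-∘
    ; η = ηᶻ ; μ = μᶻ ; η-nat = ηᶻ-nat ; μ-nat = μᶻ-nat
    ; μ-assoc = μᶻ-assoc ; μ-unitˡ = μᶻ-unitˡ ; μ-unitʳ = μᶻ-unitʳ
    ; τ = τᶻ ; τ-nat = τᶻ-nat ; τ-λ = τᶻ-λ ; τ-α = τᶻ-α ; τ-η = τᶻ-η ; τ-μ = τᶻ-μ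
    }

  ι-τʳᶻ : ∀ X Y → ι (X ⊗₀ Y) ∘ τ′ M 𝒵 X Y ≡ τʳ X Y ∘ (ι X ⊗₁ id)
  ι-τʳᶻ X Y = begin
    ι _ ∘ F₁ᶻ γ ∘ τᶻ Y X ∘ γ           ≡⟨ trans (pullˡ (ι-F₁ᶻ γ)) assoc ⟩
    F₁ γ ∘ ι _ ∘ τᶻ Y X ∘ γ            ≡⟨ refl⟩∘⟨ trans (pullˡ (ι-τᶻ Y X)) assoc ⟩
    F₁ γ ∘ τ Y X ∘ (id ⊗₁ ι X) ∘ γ     ≡⟨ refl⟩∘⟨ refl⟩∘⟨ sym γ-nat ⟩
    F₁ γ ∘ τ Y X ∘ γ ∘ (ι X ⊗₁ id)     ≡⟨ trans (refl⟩∘⟨ sym-assoc) sym-assoc ⟩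
    τʳ X Y ∘ (ι X ⊗₁ id)               ∎

  -- Commutativity of 𝒵 is centrality of ι X tested against ι Y.
  𝒵-commutative : IsCommutative M 𝒵
  𝒵-commutative X Y = ι-cancel (begin
    ι _ ∘ μᶻ _ ∘ F₁ᶻ (τ′ M 𝒵 X Y) ∘ τᶻ (Z₀ X) Y         ≡⟨ ι-μᶻ-F₁ᶻ-∘ _ _ ⟩
    extend (ι _ ∘ τ′ M 𝒵 X Y) ∘ ι _ ∘ τᶻ (Z₀ X) Y       ≡⟨ cong extend (ι-τʳᶻ X Y) ⟩∘⟨ ι-τᶻ (Z₀ X) Y ⟩
    pairʳˡ (ι X) (ι Y)                                  ≡⟨ ι-central X (ι Y) ⟩
    pairˡʳ (ι X) (ι Y)                                  ≡⟨ cong extend (sym (ι-τᶻ X Y)) ⟩∘⟨ sym (ι-τʳᶻ X (Z₀ Y)) ⟩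
    extend (ι _ ∘ τᶻ X Y) ∘ ι _ ∘ τ′ M 𝒵 X (Z₀ Y)       ≡⟨ sym (ι-μᶻ-F₁ᶻ-∘ _ _) ⟩
    ι _ ∘ μᶻ _ ∘ F₁ᶻ (τᶻ X Y) ∘ τ′ M 𝒵 X (Z₀ Y)         ∎)

  ι-isStrongMonadMorphism : IsStrongMonadMorphism M 𝒵 T ι
  ι-isStrongMonadMorphism = record
    { natural = ι-F₁ᶻ
    ; unit-law = ι-ηᶻ
    ; mult-law = λ X → trans (ι-μᶻ X) assoc
    ; strength-law = ι-τᶻ
    }

  ι-isStrongMonadMono : IsStrongMonadMono M 𝒵 T ι
  ι-isStrongMonadMono _ _ _ _ _ ια≡ιβ X = ι-cancel (ια≡ιβ X)

mainTheorem6 : ∀ {o ℓ} {C : Category o ℓ} (M : SymmetricMonoidal C)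
                 {T₀ : Category.Obj C → Category.Obj C} (T : StrongMonadOn M T₀)
                 (Z : Centralisable M T) →
                 Σ (StrongMonadOn M (λ X → CentralCone.obj (proj₁ (Z X)))) λ 𝒵 →
                   IsCommutative M 𝒵
                   × IsStrongMonadMorphism M 𝒵 T (λ X → CentralCone.arr (proj₁ (Z X)))
                   × IsStrongMonadMono M 𝒵 T (λ X → CentralCone.arr (proj₁ (Z X)))
mainTheorem6 M T Z = 𝒵 , 𝒵-commutative , ι-isStrongMonadMorphism , ι-isStrongMonadMono
  where open Centre M T Z
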